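{- Let $l\ge 1$ and $\Delta\ge 1$, and let $T$ be the $l$-generalized star graph obtained from the star with $\Delta$ leaves (so $T$ has $n=l\Delta+1$ nodes). Then \[|E_{fix}(T)| = \sum_{i=0}^{\lfloor \Delta/2\rfloor}\binom{\Delta}{i} F_{l-1}^{\,i}\,F_l^{\,\Delta-i},\] with the convention $0^0=1$.
   Context: A star graph with $\Delta$ leaves is a tree consisting of a center node adjacent to $\Delta$ leaves. The $l$-generalized star graph is obtained from it by inserting $l-1$ new nodes into each edge, i.e., replacing each edge by a path with $l$ edges. For a tree $T=(V,E)$, $E_{fix}(T)$ is the set of all $F\subseteq E$ with $2deg_F(v)\le deg(v)$ for every $v\in V$, where $deg_F(v)$ is the number of edges of $F$ incident to $v$ and $deg(v)$ is the degree of $v$ in $T$. $F_i$ denotes the $i$-th Fibonacci number: $F_0=0$, $F_1=1$, $F_i=F_{i-1}+F_{i-2}$. -}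

module Defs where

open import Data.Nat using (ℕ; zero; suc; _+_; _*_; _^_; _≤ᵇ_; _/_)
open import Data.Nat.Combinatorics using (_C_)
open import Data.Bool using (Bool; true; false; if_then_else_; _∧_; _∨_)
open import Data.List using (List; []; _∷_; map; _++_; length; filter; upTo; concatMap)
open import Data.Nat.ListAction using (sum)
open import Data.Vec using (Vec; []; _∷_)
open import Data.Product using (_×_; _,_)
open import Relation.Binary.PropositionalEquality using (_≡_)

fib : ℕ → ℕ
fib zero = 0
fib (suc zero) = 1
fib (suc (suc i)) = fib (suc i) + fib i

-- A (finite, undirected) graph given by its vertex set {0,…,n-1} and its edge list.
record Graph : Set where
  field
    nV    : ℕ
    edges : List (ℕ × ℕ)
open Graph public

-- Vertex 0 is the center; for the
-- j-th path (j < Δ) the vertex at distance k+1 from the center (k < l)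
-- is 1 + j*l + k.
genStar : (l Δ : ℕ) → Graph
genStar l Δ = record
  { nV    = l * Δ + 1
  ; edges = concatMap (λ j → map (λ k → edge j k) (upTo l)) (upTo Δ)
  }
  where
  edge : ℕ → ℕ → ℕ × ℕ
  edge j zero    = (0 , 1 + j * l)
  edge j (suc k) = (1 + j * l + k , 1 + j * l + suc k)

incident : ℕ → ℕ × ℕ → Bool
incident v (a , b) = (v ≡ᵇ' a) ∨ (v ≡ᵇ' b)
  where
  open import Data.Nat using () renaming (_≡ᵇ_ to _≡ᵇ'_)

count : List Bool → ℕ
count [] = 0
count (true ∷ bs) = suc (count bs)
count (false ∷ bs) = count bs

deg : Graph → ℕ → ℕ
deg G v = count (map (incident v) (edges G))

EdgeSubset : Graph → Set
EdgeSubset G = Vec Bool (length (edges G))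

degF : (G : Graph) → EdgeSubset G → ℕ → ℕ
degF G F v = go (edges G) F
  where
  go : (es : List (ℕ × ℕ)) → Vec Bool (length es) → ℕ
  go [] [] = 0
  go (e ∷ es) (true ∷ bs) = (if incident v e then 1 else 0) + go es bs
  go (e ∷ es) (false ∷ bs) = go es bs

allSubsets : (m : ℕ) → List (Vec Bool m)
allSubsets zero = [] ∷ []
allSubsets (suc m) = map (true ∷_) (allSubsets m) ++ map (false ∷_) (allSubsets m)

allL : {A : Set} → (A → Bool) → List A → Bool
allL p [] = true
allL p (x ∷ xs) = p x ∧ allL p xs

isFix : (G : Graph) → EdgeSubset G → Bool
isFix G F = allL (λ v → (2 * degF G F v) ≤ᵇ deg G v) (upTo (nV G))

numFix : Graph → ℕ
numFix G = length (filter (λ F → isFix G F ≡ᵇ true) (allSubsets (length (edges G))))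
  where
  open import Data.Bool using () renaming (_≟_ to _≡ᵇ_)

sumTo : ℕ → (ℕ → ℕ) → ℕ
sumTo N f = sum (map f (upTo (suc N)))

-- right-hand side: Σ_{i=0}^{⌊Δ/2⌋} C(Δ,i) F_{l-1}^i F_l^{Δ-i}   (with 0^0 = 1, as in ℕ's _^_)
starFormula : (l Δ : ℕ) → ℕ
starFormula l Δ = sumTo (Δ / 2) (λ i → (Δ C i) * (fib (l ∸' 1) ^ i) * (fib l ^ (Δ ∸' i)))
  where
  open import Data.Nat using () renaming (_∸_ to _∸'_)

-- F is fixed iff it has at most ⌊Δ/2⌋ edges at the centre, at most one edge at
-- each inner vertex of a spoke and no edge at a leaf.  On a single spoke this
-- means: no two consecutive edges and not the leaf edge.  Deciding the edge
-- nearest to the centre first gives the Fibonacci recursion: F_{l-1} such edge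
-- sets contain the centre edge and F_l do not.  Spokes share only the centre, so
-- choosing the i ≤ ⌊Δ/2⌋ spokes whose centre edge is in F gives the sum
-- Σ C(Δ,i) F_{l-1}^i F_l^{Δ-i}.

module Submission where

open import Defs
open import Data.Bool using (Bool; true; false; _∧_; T; if_then_else_)
open import Data.Bool.Properties using (∧-assoc; ∧-comm; ∧-zeroʳ; ∨-zeroʳ; ⇔→≡; T-≡)
import Data.Bool as Bool
open import Data.List using (List; []; _∷_; [_]; _++_; map; concat; concatMap; filter; length; upTo; applyUpTo)
open import Data.List.Properties using (map-++; map-∘; map-cong; map-applyUpTo; map-upTo)
open import Data.List.Relation.Unary.All as All using (All; []; _∷_)
open import Data.List.Relation.Unary.All.Properties using (++⁺)
open import Data.List.Relation.Binary.Sublist.Propositional using (_⊆_; []; _∷_; _∷ʳ_)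
open import Data.Nat
open import Data.Nat.Properties
open import Data.Nat.Solver using (module +-*-Solver)
open import Data.Nat.DivMod using (m*n/n≡m; /-monoˡ-≤; m/n*n≤m)
open import Data.Nat.Combinatorics using (_C_; nCk+nC[k+1]≡[n+1]C[k+1]; k>n⇒nCk≡0)
open import Data.Nat.ListAction using (sum)
open import Data.Nat.ListAction.Properties using (sum-++)
open import Data.Empty using (⊥-elim)
open import Data.Product using (_×_; _,_)
open import Data.Vec using (Vec; []; _∷_)
open import Function using (_∘_; mk⇔; Equivalence)
open import Relation.Binary.PropositionalEquality hiding ([_])
open import Relation.Nullary using (yes; no)

open +-*-Solver

Edge : Set
Edge = ℕ × ℕ

iverson : Bool → ℕ
iverson b = if b then 1 else 0

degree : List Edge → ℕ → ℕ
degree S v = count (map (incident v) S)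

selected : (E : List Edge) → Vec Bool (length E) → List Edge
selected []      []          = []
selected (e ∷ E) (true  ∷ F) = e ∷ selected E F
selected (e ∷ E) (false ∷ F) = selected E F

fixAt : List Edge → List Edge → ℕ → Bool
fixAt E S v = 2 * degree S v ≤ᵇ degree E v

fixOn : List Edge → List ℕ → List Edge → Bool
fixOn E vs S = allL (fixAt E S) vs

iverson-∧∧ : ∀ x y z → iverson ((x ∧ y) ∧ z) ≡ iverson x * iverson (y ∧ z)
iverson-∧∧ true  y z = sym (+-identityʳ _)
iverson-∧∧ false y z = refl

allL-++ : {A : Set} (p : A → Bool) (xs ys : List A) → allL p (xs ++ ys) ≡ allL p xs ∧ allL p ys
allL-++ p []       ys = refl
allL-++ p (x ∷ xs) ys = trans (cong (p x ∧_) (allL-++ p xs ys)) (sym (∧-assoc (p x) _ _))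

allL-cong : {A : Set} {p q : A → Bool} {xs : List A} → All (λ x → p x ≡ q x) xs → allL p xs ≡ allL q xs
allL-cong []         = refl
allL-cong (px≡qx ∷ h) = cong₂ _∧_ px≡qx (allL-cong h)

applyUpTo-cong : {A : Set} {f g : ℕ → A} → (∀ i → f i ≡ g i) → ∀ n → applyUpTo f n ≡ applyUpTo g n
applyUpTo-cong f≗g zero    = refl
applyUpTo-cong f≗g (suc n) = cong₂ _∷_ (f≗g 0) (applyUpTo-cong (f≗g ∘ suc) n)

applyUpTo-+ : {A : Set} (f : ℕ → A) (a b : ℕ) → applyUpTo f (a + b) ≡ applyUpTo f a ++ applyUpTo (λ i → f (a + i)) b
applyUpTo-+ f zero    b = refl
applyUpTo-+ f (suc a) b = cong (f 0 ∷_) (applyUpTo-+ (f ∘ suc) a b)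

length-filter : {A : Set} (p : A → Bool) (xs : List A) →
                length (filter (λ x → p x Bool.≟ true) xs) ≡ sum (map (iverson ∘ p) xs)
length-filter p []       = refl
length-filter p (x ∷ xs) with p x
... | true  = cong suc (length-filter p xs)
... | false = length-filter p xs

sumSublists : {A : Set} → List A → (List A → ℕ) → ℕ
sumSublists []      g = g []
sumSublists (x ∷ X) g = sumSublists X (λ S → g (x ∷ S)) + sumSublists X g

module _ {A : Set} where

  sumSublists-cong : (X : List A) {g h : List A → ℕ} → (∀ S → S ⊆ X → g S ≡ h S) → sumSublists X g ≡ sumSublists X h
  sumSublists-cong []      g≗h = g≗h [] []
  sumSublists-cong (x ∷ X) g≗h = cong₂ _+_ (sumSublists-cong X (λ S S⊆X → g≗h (x ∷ S) (refl ∷ S⊆X)))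
                                            (sumSublists-cong X (λ S S⊆X → g≗h S (x ∷ʳ S⊆X)))

  sumSublists-zero : (X : List A) → sumSublists X (λ _ → 0) ≡ 0
  sumSublists-zero []      = refl
  sumSublists-zero (x ∷ X) = cong₂ _+_ (sumSublists-zero X) (sumSublists-zero X)

  sumSublists-++ : (X Y : List A) (g : List A → ℕ) →
                   sumSublists (X ++ Y) g ≡ sumSublists X (λ S → sumSublists Y (λ S′ → g (S ++ S′)))
  sumSublists-++ []      Y g = refl
  sumSublists-++ (x ∷ X) Y g = cong₂ _+_ (sumSublists-++ X Y (λ S → g (x ∷ S))) (sumSublists-++ X Y g)

  sumSublists-*ˡ : (X : List A) (c : ℕ) (g : List A → ℕ) → sumSublists X (λ S → c * g S) ≡ c * sumSublists X g
  sumSublists-*ˡ []      c g = refl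
  sumSublists-*ˡ (x ∷ X) c g = trans (cong₂ _+_ (sumSublists-*ˡ X c _) (sumSublists-*ˡ X c g))
                                     (sym (*-distribˡ-+ c _ _))

  sumSublists-* : (X Y : List A) (f g : List A → ℕ) →
                  sumSublists X (λ S → sumSublists Y (λ S′ → f S * g S′)) ≡ sumSublists X f * sumSublists Y g
  sumSublists-* X Y f g = begin
    sumSublists X (λ S → sumSublists Y (λ S′ → f S * g S′)) ≡⟨ sumSublists-cong X (λ S _ → sumSublists-*ˡ Y (f S) g) ⟩
    sumSublists X (λ S → f S * sumSublists Y g)             ≡⟨ sumSublists-cong X (λ S _ → *-comm (f S) _) ⟩
    sumSublists X (λ S → sumSublists Y g * f S)             ≡⟨ sumSublists-*ˡ X (sumSublists Y g) f ⟩
    sumSublists Y g * sumSublists X f                       ≡⟨ *-comm _ (sumSublists X f) ⟩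
    sumSublists X f * sumSublists Y g                       ∎
    where open ≡-Reasoning

degF≡degree-selected : ∀ n E F v → degF (record { nV = n ; edges = E }) F v ≡ degree (selected E F) v
degF≡degree-selected n []      []          v = refl
degF≡degree-selected n (e ∷ E) (true ∷ F)  v with incident v e
... | true  = cong suc (degF≡degree-selected n E F v)
... | false = degF≡degree-selected n E F v
degF≡degree-selected n (e ∷ E) (false ∷ F) v = degF≡degree-selected n E F v

isFix≡fixOn : ∀ G F → isFix G F ≡ fixOn (edges G) (upTo (nV G)) (selected (edges G) F)
isFix≡fixOn G F = allL-cong {xs = upTo (nV G)} (All.universal
  (λ v → cong (λ d → 2 * d ≤ᵇ deg G v) (degF≡degree-selected (nV G) (edges G) F v)) _)

sum-allSubsets : (E : List Edge) (g : List Edge → ℕ) →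
                 sum (map (g ∘ selected E) (allSubsets (length E))) ≡ sumSublists E g
sum-allSubsets []      g = +-identityʳ (g [])
sum-allSubsets (e ∷ E) g = begin
  sum (map h (map (true ∷_) F ++ map (false ∷_) F))
    ≡⟨ cong sum (map-++ h (map (true ∷_) F) _) ⟩
  sum (map h (map (true ∷_) F) ++ map h (map (false ∷_) F))
    ≡⟨ sum-++ (map h (map (true ∷_) F)) _ ⟩
  sum (map h (map (true ∷_) F)) + sum (map h (map (false ∷_) F))
    ≡⟨ cong₂ (λ xs ys → sum xs + sum ys) (sym (map-∘ F)) (sym (map-∘ F)) ⟩
  sum (map (g ∘ (e ∷_) ∘ selected E) F) + sum (map (g ∘ selected E) F)
    ≡⟨ cong₂ _+_ (sum-allSubsets E (g ∘ (e ∷_))) (sum-allSubsets E g) ⟩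
  sumSublists (e ∷ E) g ∎
  where
  open ≡-Reasoning
  F = allSubsets (length E)
  h = g ∘ selected (e ∷ E)

numFix≡sumSublists : ∀ G → numFix G ≡ sumSublists (edges G) (λ S → iverson (fixOn (edges G) (upTo (nV G)) S))
numFix≡sumSublists G = begin
  numFix G                                                            ≡⟨ length-filter (isFix G) subsets ⟩
  sum (map (iverson ∘ isFix G) subsets)                               ≡⟨ cong sum (map-cong (cong iverson ∘ isFix≡fixOn G) subsets) ⟩
  sum (map ((λ S → iverson (fixOn E (upTo (nV G)) S)) ∘ selected E) subsets) ≡⟨ sum-allSubsets E _ ⟩
  sumSublists E (λ S → iverson (fixOn E (upTo (nV G)) S))             ∎
  where
  open ≡-Reasoning
  E = edges G
  subsets = allSubsets (length E)

≡ᵇ-refl : ∀ n → (n ≡ᵇ n) ≡ true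
≡ᵇ-refl n = Equivalence.to T-≡ (≡⇒≡ᵇ n n refl)

≢⇒≡ᵇ-false : ∀ {m n} → m ≢ n → (m ≡ᵇ n) ≡ false
≢⇒≡ᵇ-false {m} {n} m≢n with m ≡ᵇ n in eq
... | true  = ⊥-elim (m≢n (≡ᵇ⇒≡ m n (subst T (sym eq) _)))
... | false = refl

incident-fst : ∀ a b → incident a (a , b) ≡ true
incident-fst a b rewrite ≡ᵇ-refl a = refl

incident-snd : ∀ a b → incident b (a , b) ≡ true
incident-snd a b rewrite ≡ᵇ-refl b = ∨-zeroʳ (b ≡ᵇ a)

incident-≢ : ∀ {v a b} → v ≢ a → v ≢ b → incident v (a , b) ≡ false
incident-≢ v≢a v≢b rewrite ≢⇒≡ᵇ-false v≢a | ≢⇒≡ᵇ-false v≢b = refl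

degree-∷ : ∀ e S v → degree (e ∷ S) v ≡ iverson (incident v e) + degree S v
degree-∷ e S v with incident v e
... | true  = refl
... | false = refl

degree-∷-incident : ∀ e S v → incident v e ≡ true → degree (e ∷ S) v ≡ suc (degree S v)
degree-∷-incident e S v inc = trans (degree-∷ e S v) (cong (λ b → iverson b + degree S v) inc)

degree-∷-≢ : ∀ {a b} S {v} → v ≢ a → v ≢ b → degree ((a , b) ∷ S) v ≡ degree S v
degree-∷-≢ {a} {b} S {v} v≢a v≢b = trans (degree-∷ (a , b) S v) (cong (λ x → iverson x + degree S v) (incident-≢ v≢a v≢b))

degree-++ : ∀ S S′ v → degree (S ++ S′) v ≡ degree S v + degree S′ v
degree-++ []      S′ v = refl
degree-++ (e ∷ S) S′ v = begin
  degree (e ∷ S ++ S′) v                                  ≡⟨ degree-∷ e (S ++ S′) v ⟩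
  iverson (incident v e) + degree (S ++ S′) v             ≡⟨ cong (iverson (incident v e) +_) (degree-++ S S′ v) ⟩
  iverson (incident v e) + (degree S v + degree S′ v)     ≡⟨ sym (+-assoc (iverson (incident v e)) _ _) ⟩
  iverson (incident v e) + degree S v + degree S′ v       ≡⟨ cong (_+ degree S′ v) (sym (degree-∷ e S v)) ⟩
  degree (e ∷ S) v + degree S′ v                          ∎
  where open ≡-Reasoning

degree-mono : ∀ {S E} v → S ⊆ E → degree S v ≤ degree E v
degree-mono v [] = ≤-refl
degree-mono {E = e ∷ E} v (.e ∷ʳ S⊆E) = ≤-trans (degree-mono v S⊆E) (≤-trans (m≤n+m _ _) (≤-reflexive (sym (degree-∷ e E v))))
degree-mono {e ∷ S} {.e ∷ E} v (refl ∷ S⊆E) = begin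
  degree (e ∷ S) v                        ≡⟨ degree-∷ e S v ⟩
  iverson (incident v e) + degree S v     ≤⟨ +-monoʳ-≤ (iverson (incident v e)) (degree-mono v S⊆E) ⟩
  iverson (incident v e) + degree E v     ≡⟨ degree-∷ e E v ⟨
  degree (e ∷ E) v                        ∎
  where open ≤-Reasoning

⊆-degree-≡0 : ∀ {S E v} → S ⊆ E → degree E v ≡ 0 → degree S v ≡ 0
⊆-degree-≡0 {v = v} S⊆E deg≡0 = n≤0⇒n≡0 (subst (_ ≤_) deg≡0 (degree-mono v S⊆E))

-- Locality of the fixing condition

fixAt-++ˡ : ∀ E {E′} S {S′ v} → degree E′ v ≡ 0 → degree S′ v ≡ 0 → fixAt (E ++ E′) (S ++ S′) v ≡ fixAt E S v
fixAt-++ˡ E {E′} S {S′} {v} E′≡0 S′≡0 = cong₂ (λ s e → 2 * s ≤ᵇ e)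
  (trans (degree-++ S S′ v) (trans (cong (degree S v +_) S′≡0) (+-identityʳ _)))
  (trans (degree-++ E E′ v) (trans (cong (degree E v +_) E′≡0) (+-identityʳ _)))

fixAt-++ʳ : ∀ E {E′} S {S′ v} → degree E v ≡ 0 → degree S v ≡ 0 → fixAt (E ++ E′) (S ++ S′) v ≡ fixAt E′ S′ v
fixAt-++ʳ E {E′} S {S′} {v} E≡0 S≡0 = cong₂ (λ s e → 2 * s ≤ᵇ e)
  (trans (degree-++ S S′ v) (cong (_+ degree S′ v) S≡0))
  (trans (degree-++ E E′ v) (cong (_+ degree E′ v) E≡0))

fixOn-++ˡ : ∀ E {E′ vs} S {S′} → All (λ v → degree E′ v ≡ 0) vs → S′ ⊆ E′ →
            fixOn (E ++ E′) vs (S ++ S′) ≡ fixOn E vs S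
fixOn-++ˡ E S away S′⊆E′ = allL-cong (All.map (λ {v} E′≡0 → fixAt-++ˡ E S {v = v} E′≡0 (⊆-degree-≡0 {v = v} S′⊆E′ E′≡0)) away)

fixOn-++ʳ : ∀ E {E′ vs} S {S′} → All (λ v → degree E v ≡ 0) vs → S ⊆ E →
            fixOn (E ++ E′) vs (S ++ S′) ≡ fixOn E′ vs S′
fixOn-++ʳ E S away S⊆E = allL-cong (All.map (λ {v} E≡0 → fixAt-++ʳ E S {v = v} E≡0 (⊆-degree-≡0 {v = v} S⊆E E≡0)) away)

path : ℕ → ℕ → List Edge
path c zero    = []
path c (suc n) = (c , suc c) ∷ path (suc c) n

spoke : ℕ → ℕ → ℕ → List Edge
spoke b c n = (b , c) ∷ path c n

pathVertices : ℕ → ℕ → List ℕ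
pathVertices c zero    = c ∷ []
pathVertices c (suc n) = c ∷ pathVertices (suc c) n

spokeFix : ℕ → ℕ → ℕ → List Edge → Bool
spokeFix b c n = fixOn (spoke b c n) (pathVertices c n)

pathVertices-≥ : ∀ c n → All (c ≤_) (pathVertices c n)
pathVertices-≥ c zero    = ≤-refl ∷ []
pathVertices-≥ c (suc n) = ≤-refl ∷ All.map <⇒≤ (pathVertices-≥ (suc c) n)

pathVertices-≤ : ∀ c n → All (_≤ c + n) (pathVertices c n)
pathVertices-≤ c zero    = m≤m+n c 0 ∷ []
pathVertices-≤ c (suc n) = m≤m+n c (suc n) ∷ All.map (λ v≤ → ≤-trans v≤ (≤-reflexive (sym (+-suc c n)))) (pathVertices-≤ (suc c) n)

applyUpTo-pathVertices : ∀ c n → applyUpTo (c +_) (suc n) ≡ pathVertices c n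
applyUpTo-pathVertices c zero    = cong (_∷ []) (+-identityʳ c)
applyUpTo-pathVertices c (suc n) =
  cong₂ _∷_ (+-identityʳ c) (trans (applyUpTo-cong (+-suc c) (suc n)) (applyUpTo-pathVertices (suc c) n))

degree-path-below : ∀ {v c} n → v < c → degree (path c n) v ≡ 0
degree-path-below zero    v<c = refl
degree-path-below {c = c} (suc n) v<c =
  trans (degree-∷-≢ (path (suc c) n) (<⇒≢ v<c) (<⇒≢ (m<n⇒m<1+n v<c))) (degree-path-below n (m<n⇒m<1+n v<c))

degree-path-above : ∀ {v} c n → c + n < v → degree (path c n) v ≡ 0
degree-path-above c zero    c<v = refl
degree-path-above {v} c (suc n) c+n<v =
  trans (degree-∷-≢ (path (suc c) n) (>⇒≢ (<-trans (n<1+n c) 1+c<v)) (>⇒≢ 1+c<v)) (degree-path-above (suc c) n 1+c+n<v)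
  where
  1+c+n<v = subst (_< v) (+-suc c n) c+n<v
  1+c<v   = ≤-<-trans (m≤m+n (suc c) n) 1+c+n<v

fixAt-value : ∀ E S v {e s} → degree E v ≡ e → degree S v ≡ s → fixAt E S v ≡ (2 * s ≤ᵇ e)
fixAt-value E S v E≡e S≡s = cong₂ (λ s e → 2 * s ≤ᵇ e) S≡s E≡e

module _ {b c : ℕ} (b<c : b < c) (n : ℕ) where

  degree-start : ∀ {P} → P ⊆ path (suc c) n → degree P c ≡ 0
  degree-start P⊆ = ⊆-degree-≡0 {v = c} P⊆ (degree-path-below n (n<1+n c))

  degree-spoke-start : degree (spoke b c (suc n)) c ≡ 2
  degree-spoke-start = trans (degree-∷-incident (b , c) (path c (suc n)) c (incident-snd b c))
    (cong suc (trans (degree-∷-incident (c , suc c) (path (suc c) n) c (incident-fst c (suc c))) (cong suc (degree-path-below n (n<1+n c)))))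

  -- Beyond c the edge b—c is invisible, so only the condition at c couples the first edge to the rest.
  spokeFix-suc : ∀ {T} S → T ⊆ [ (b , c) ] →
                 spokeFix b c (suc n) (T ++ S) ≡ fixAt (spoke b c (suc n)) (T ++ S) c ∧ spokeFix c (suc c) n S
  spokeFix-suc {T} S T⊆ = cong (fixAt (spoke b c (suc n)) (T ++ S) c ∧_) (fixOn-++ʳ [ (b , c) ] T away T⊆)
    where
    away : All (λ v → degree [ (b , c) ] v ≡ 0) (pathVertices (suc c) n)
    away = All.map (λ c<v → degree-∷-≢ [] (>⇒≢ (<-trans b<c c<v)) (>⇒≢ c<v)) (pathVertices-≥ (suc c) n)

  degree-start-∷ : ∀ e {P} → incident c e ≡ true → P ⊆ path (suc c) n → degree (e ∷ P) c ≡ 1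
  degree-start-∷ e {P} inc P⊆ = trans (degree-∷-incident e P c inc) (cong suc (degree-start P⊆))

  spokeFix-both : ∀ {P} → P ⊆ path (suc c) n → spokeFix b c (suc n) ((b , c) ∷ (c , suc c) ∷ P) ≡ false
  spokeFix-both {P} P⊆ = cong (_∧ fixOn (spoke b c (suc n)) (pathVertices (suc c) n) S) (fixAt-value (spoke b c (suc n)) S c degree-spoke-start S≡2)
    where
    S = (b , c) ∷ (c , suc c) ∷ P
    S≡2 : degree S c ≡ 2
    S≡2 = trans (degree-∷-incident (b , c) _ c (incident-snd b c)) (cong suc (degree-start-∷ (c , suc c) (incident-fst c (suc c)) P⊆))

  spokeFix-at-most-one : ∀ {T} S → T ⊆ [ (b , c) ] → degree (T ++ S) c ≤ 1 →
                         spokeFix b c (suc n) (T ++ S) ≡ spokeFix c (suc c) n S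
  spokeFix-at-most-one {T} S T⊆ deg≤1 = trans (spokeFix-suc S T⊆)
    (cong (_∧ _) (trans (fixAt-value (spoke b c (suc n)) (T ++ S) c degree-spoke-start refl) (Equivalence.to T-≡ (≤⇒≤ᵇ (*-monoʳ-≤ 2 deg≤1)))))

-- In the successor cases the two summands are the sublists with and without the edge c—c+1.
spokeCount-with    : ∀ {b c} n → b < c → sumSublists (path c n) (λ S → iverson (spokeFix b c n ((b , c) ∷ S))) ≡ fib n
spokeCount-without : ∀ {b c} n → b < c → sumSublists (path c n) (λ S → iverson (spokeFix b c n S)) ≡ fib (suc n)

spokeCount-with {b} {c} zero b<c =
  cong (λ d → iverson ((2 * d ≤ᵇ d) ∧ true)) (degree-∷-incident (b , c) [] c (incident-snd b c))
spokeCount-with {b} {c} (suc n) b<c = cong₂ _+_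
  (trans (sumSublists-cong (path (suc c) n) (λ P P⊆ → cong iverson (spokeFix-both b<c n P⊆)))
         (sumSublists-zero (path (suc c) n)))
  (trans (sumSublists-cong (path (suc c) n) (λ P P⊆ → cong iverson
           (spokeFix-at-most-one b<c n P (refl ∷ []) (≤-reflexive (degree-start-∷ b<c n (b , c) (incident-snd b c) P⊆)))))
         (spokeCount-without n (n<1+n c)))

spokeCount-without zero b<c = refl
spokeCount-without {b} {c} (suc n) b<c = trans (cong₂ _+_
  (trans (sumSublists-cong (path (suc c) n) (λ P P⊆ → cong iverson
           (spokeFix-at-most-one b<c n ((c , suc c) ∷ P) ((b , c) ∷ʳ []) (≤-reflexive (degree-start-∷ b<c n (c , suc c) (incident-fst c (suc c)) P⊆)))))
         (spokeCount-with n (n<1+n c)))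
  (trans (sumSublists-cong (path (suc c) n) (λ P P⊆ → cong iverson
           (spokeFix-at-most-one b<c n P ((b , c) ∷ʳ []) (≤-trans (≤-reflexive (degree-start b<c n P⊆)) z≤n))))
         (spokeCount-without n (n<1+n c))))
  (+-comm (fib n) (fib (suc n)))

-- Partial binomial sums

binomialTerm : ℕ → ℕ → ℕ → ℕ → ℕ
binomialTerm a b n i = (n C i) * a ^ i * b ^ (n ∸ i)

binomialPrefix : ℕ → ℕ → ℕ → ℕ → ℕ
binomialPrefix a b n r = sum (applyUpTo (binomialTerm a b n) r)

sum-applyUpTo-zero : ∀ r → sum (applyUpTo (λ _ → 0) r) ≡ 0
sum-applyUpTo-zero zero    = refl
sum-applyUpTo-zero (suc r) = sum-applyUpTo-zero r

sum-applyUpTo-linear : ∀ a b (f g : ℕ → ℕ) r →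
  sum (applyUpTo (λ i → a * f i + b * g i) r) ≡ a * sum (applyUpTo f r) + b * sum (applyUpTo g r)
sum-applyUpTo-linear a b f g zero    = sym (cong₂ _+_ (*-zeroʳ a) (*-zeroʳ b))
sum-applyUpTo-linear a b f g (suc r) =
  trans (cong (a * f 0 + b * g 0 +_) (sum-applyUpTo-linear a b (f ∘ suc) (g ∘ suc) r))
        (solve 6 (λ a b x y F G → a :* x :+ b :* y :+ (a :* F :+ b :* G) := a :* (x :+ F) :+ b :* (y :+ G))
               refl a b (f 0) (g 0) (sum (applyUpTo (f ∘ suc) r)) (sum (applyUpTo (g ∘ suc) r)))

n∸i≡1+n∸[1+i] : ∀ {n i} → i < n → n ∸ i ≡ suc (n ∸ suc i)
n∸i≡1+n∸[1+i] {suc n} {zero}  _           = refl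
n∸i≡1+n∸[1+i] {suc n} {suc i} (s≤s i<n) = n∸i≡1+n∸[1+i] i<n

binomialTerm-suc : ∀ a b n i →
  binomialTerm a b (suc n) (suc i) ≡ a * binomialTerm a b n i + b * binomialTerm a b n (suc i)
binomialTerm-suc a b n i = begin
  (suc n C suc i) * a ^ suc i * b ^ (n ∸ i)
    ≡⟨ cong (λ k → k * a ^ suc i * b ^ (n ∸ i)) (sym (nCk+nC[k+1]≡[n+1]C[k+1] n i)) ⟩
  (n C i + n C suc i) * (a * a ^ i) * b ^ (n ∸ i)
    ≡⟨ solve 5 (λ x y a aⁱ p → (x :+ y) :* (a :* aⁱ) :* p := a :* (x :* aⁱ :* p) :+ (y :* p) :* (a :* aⁱ))
             refl (n C i) (n C suc i) a (a ^ i) (b ^ (n ∸ i)) ⟩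
  a * binomialTerm a b n i + ((n C suc i) * b ^ (n ∸ i)) * (a * a ^ i)
    ≡⟨ cong (λ z → a * binomialTerm a b n i + z * (a * a ^ i)) peel ⟩
  a * binomialTerm a b n i + ((n C suc i) * (b * b ^ (n ∸ suc i))) * (a * a ^ i)
    ≡⟨ cong (a * binomialTerm a b n i +_)
         (solve 5 (λ y b q a aⁱ → (y :* (b :* q)) :* (a :* aⁱ) := b :* (y :* (a :* aⁱ) :* q))
                refl (n C suc i) b (b ^ (n ∸ suc i)) a (a ^ i)) ⟩
  a * binomialTerm a b n i + b * binomialTerm a b n (suc i) ∎
  where
  open ≡-Reasoning
  peel : (n C suc i) * b ^ (n ∸ i) ≡ (n C suc i) * (b * b ^ (n ∸ suc i))
  peel with i <? n
  ... | yes i<n = cong (λ k → (n C suc i) * b ^ k) (n∸i≡1+n∸[1+i] i<n)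
  ... | no  i≮n rewrite k>n⇒nCk≡0 {n} {suc i} (s≤s (≮⇒≥ i≮n)) = refl

binomialPrefix-zero : ∀ a b r → binomialPrefix a b 0 (suc r) ≡ 1
binomialPrefix-zero a b r = cong suc (sum-applyUpTo-zero r)

binomialPrefix-suc : ∀ a b n r →
  binomialPrefix a b (suc n) (suc r) ≡ a * binomialPrefix a b n r + b * binomialPrefix a b n (suc r)
binomialPrefix-suc a b n r = begin
  binomialTerm a b (suc n) 0 + sum (applyUpTo (binomialTerm a b (suc n) ∘ suc) r)
    ≡⟨ cong (binomialTerm a b (suc n) 0 +_)
         (trans (cong sum (applyUpTo-cong (binomialTerm-suc a b n) r))
                (sum-applyUpTo-linear a b (binomialTerm a b n) (binomialTerm a b n ∘ suc) r)) ⟩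
  binomialTerm a b (suc n) 0 + (a * P + b * Q)
    ≡⟨ solve 5 (λ a b p P Q → con 1 :* con 1 :* (b :* p) :+ (a :* P :+ b :* Q) := a :* P :+ b :* (con 1 :* con 1 :* p :+ Q))
             refl a b (b ^ n) P Q ⟩
  a * P + b * (binomialTerm a b n 0 + Q) ∎
  where
  open ≡-Reasoning
  P = binomialPrefix a b n r
  Q = sum (applyUpTo (binomialTerm a b n ∘ suc) r)

-- The generalized star

applyUpTo-path : ∀ c n (h : ℕ → Edge) → (∀ k → h k ≡ (c + k , c + suc k)) → applyUpTo h n ≡ path c n
applyUpTo-path c zero    h h≗ = refl
applyUpTo-path c (suc n) h h≗ =
  cong₂ _∷_ (trans (h≗ 0) (cong₂ _,_ (+-identityʳ c) (trans (+-suc c 0) (cong suc (+-identityʳ c)))))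
            (applyUpTo-path (suc c) n (h ∘ suc) (λ k → trans (h≗ (suc k)) (cong₂ _,_ (+-suc c k) (+-suc c (suc k)))))

2*m≤ᵇn≡m<ᵇ1+n/2 : ∀ m n → (2 * m ≤ᵇ n) ≡ (m <ᵇ suc (n / 2))
2*m≤ᵇn≡m<ᵇ1+n/2 m n = ⇔→≡ {z = true} (mk⇔
  (λ h → Equivalence.to T-≡ (<⇒<ᵇ (s≤s (halve (≤ᵇ⇒≤ _ _ (Equivalence.from T-≡ h))))))
  (λ h → Equivalence.to T-≡ (≤⇒≤ᵇ (double (≤-pred (<ᵇ⇒< _ _ (Equivalence.from T-≡ h)))))))
  where
  halve : 2 * m ≤ n → m ≤ n / 2
  halve h = subst (_≤ n / 2) (m*n/n≡m m 2) (/-monoˡ-≤ 2 (subst (_≤ n) (*-comm 2 m) h))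
  double : m ≤ n / 2 → 2 * m ≤ n
  double h = ≤-trans (*-monoʳ-≤ 2 h) (subst (_≤ n) (*-comm (n / 2) 2) (m/n*n≤m n 2))

module Star (m : ℕ) where

  spokes : ℕ → ℕ → List Edge
  spokes c zero    = []
  spokes c (suc n) = spoke 0 c m ++ spokes (c + suc m) n

  starVertices : ℕ → ℕ → List ℕ
  starVertices c zero    = []
  starVertices c (suc n) = pathVertices c m ++ starVertices (c + suc m) n

  -- With a strict bound on the centre degree, the bound 0 admits nothing, as for binomialPrefix.
  starCount : ℕ → ℕ → ℕ → ℕ
  starCount c n r = sumSublists (spokes c n) (λ S → iverson (fixOn (spokes c n) (starVertices c n) S ∧ (degree S 0 <ᵇ r)))

  spokes-concatMap : ∀ c Δ (f : ℕ → ℕ → Edge) →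
                     (∀ j → f j 0 ≡ (0 , c + j * suc m)) →
                     (∀ j k → f j (suc k) ≡ (c + j * suc m + k , c + j * suc m + suc k)) →
                     concatMap (λ j → map (f j) (upTo (suc m))) (upTo Δ) ≡ spokes c Δ
  spokes-concatMap c zero    f f₀ fₛ = refl
  spokes-concatMap c (suc Δ) f f₀ fₛ = cong₂ _++_
    (cong₂ _∷_ (trans (f₀ 0) (cong (0 ,_) (+-identityʳ c)))
               (trans (map-applyUpTo suc (f 0) m)
                      (applyUpTo-path c m (f 0 ∘ suc) (λ k → trans (fₛ 0 k) (cong (λ c′ → (c′ + k , c′ + suc k)) (+-identityʳ c))))))
    (trans (cong concat (trans (map-applyUpTo suc _ Δ) (sym (map-upTo _ Δ))))
           (spokes-concatMap (c + suc m) Δ (f ∘ suc)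
              (λ j → trans (f₀ (suc j)) (cong (0 ,_) (shift j)))
              (λ j k → trans (fₛ (suc j) k) (cong (λ c′ → (c′ + k , c′ + suc k)) (shift j)))))
    where
    shift : ∀ j → c + suc j * suc m ≡ c + suc m + j * suc m
    shift j = sym (+-assoc c (suc m) (j * suc m))

  genStar-edges : ∀ Δ → edges (genStar (suc m) Δ) ≡ spokes 1 Δ
  genStar-edges Δ = spokes-concatMap 1 Δ _ (λ _ → refl) (λ _ _ → refl)

  applyUpTo-starVertices : ∀ c n → applyUpTo (c +_) (n * suc m) ≡ starVertices c n
  applyUpTo-starVertices c zero    = refl
  applyUpTo-starVertices c (suc n) = trans (applyUpTo-+ (c +_) (suc m) (n * suc m)) (cong₂ _++_
    (applyUpTo-pathVertices c m)
    (trans (applyUpTo-cong (λ i → sym (+-assoc c (suc m) i)) (n * suc m)) (applyUpTo-starVertices (c + suc m) n)))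

  upTo-genStar : ∀ Δ → upTo (suc m * Δ + 1) ≡ 0 ∷ starVertices 1 Δ
  upTo-genStar Δ = trans (cong upTo (trans (+-comm _ 1) (cong suc (*-comm (suc m) Δ))))
                         (cong (0 ∷_) (applyUpTo-starVertices 1 Δ))

  degree-spokes-centre : ∀ {c} → 0 < c → ∀ n → degree (spokes c n) 0 ≡ n
  degree-spokes-centre 0<c zero    = refl
  degree-spokes-centre {c} 0<c (suc n) = trans (degree-++ (spoke 0 c m) _ 0) (cong₂ _+_
    (trans (degree-∷-incident (0 , c) (path c m) 0 (incident-fst 0 c)) (cong suc (degree-path-below m 0<c)))
    (degree-spokes-centre (<-≤-trans 0<c (m≤m+n c (suc m))) n))

  degree-spokes-below : ∀ {v c} → 0 < v → v < c → ∀ n → degree (spokes c n) v ≡ 0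
  degree-spokes-below 0<v v<c zero    = refl
  degree-spokes-below {v} {c} 0<v v<c (suc n) = trans (degree-++ (spoke 0 c m) _ v) (cong₂ _+_
    (trans (degree-∷-≢ (path c m) (>⇒≢ 0<v) (<⇒≢ v<c)) (degree-path-below m v<c))
    (degree-spokes-below 0<v (<-≤-trans v<c (m≤m+n c (suc m))) n))

  degree-spoke-beyond : ∀ {v c} → 0 < v → c + m < v → degree (spoke 0 c m) v ≡ 0
  degree-spoke-beyond {v} {c} 0<v c+m<v =
    trans (degree-∷-≢ (path c m) (>⇒≢ 0<v) (>⇒≢ (≤-<-trans (m≤m+n c m) c+m<v))) (degree-path-above c m c+m<v)

  starVertices-≥ : ∀ c n → All (c ≤_) (starVertices c n)
  starVertices-≥ c zero    = []
  starVertices-≥ c (suc n) = ++⁺ (pathVertices-≥ c m) (All.map (≤-trans (m≤m+n c (suc m))) (starVertices-≥ (c + suc m) n))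

  -- Vertices of distinct spokes are disjoint, so the condition splits spoke by spoke.
  fixOn-spokes-suc : ∀ {c n S S′} → 0 < c → S ⊆ spoke 0 c m → S′ ⊆ spokes (c + suc m) n →
    fixOn (spokes c (suc n)) (starVertices c (suc n)) (S ++ S′)
      ≡ spokeFix 0 c m S ∧ fixOn (spokes (c + suc m) n) (starVertices (c + suc m) n) S′
  fixOn-spokes-suc {c} {n} {S} {S′} 0<c S⊆ S′⊆ =
    trans (allL-++ _ (pathVertices c m) (starVertices (c + suc m) n))
          (cong₂ _∧_ (fixOn-++ˡ (spoke 0 c m) S near S′⊆) (fixOn-++ʳ (spoke 0 c m) S far S⊆))
    where
    c+m<c+l : c + m < c + suc m
    c+m<c+l = +-monoʳ-< c (n<1+n m)
    near : All (λ v → degree (spokes (c + suc m) n) v ≡ 0) (pathVertices c m)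
    near = All.map (λ (c≤v , v≤c+m) → degree-spokes-below (<-≤-trans 0<c c≤v) (≤-<-trans v≤c+m c+m<c+l) n)
                   (All.zip (pathVertices-≥ c m , pathVertices-≤ c m))
    far : All (λ v → degree (spoke 0 c m) v ≡ 0) (starVertices (c + suc m) n)
    far = All.map (λ c+l≤v → degree-spoke-beyond (<-≤-trans 0<c (≤-trans (m≤m+n c (suc m)) c+l≤v)) (<-≤-trans c+m<c+l c+l≤v))
                  (starVertices-≥ (c + suc m) n)

  fixOn-genStar : ∀ Δ S → fixOn (spokes 1 Δ) (upTo (suc m * Δ + 1)) S
                            ≡ fixOn (spokes 1 Δ) (starVertices 1 Δ) S ∧ (degree S 0 <ᵇ suc (Δ / 2))
  fixOn-genStar Δ S = begin
    fixOn E (upTo (suc m * Δ + 1)) S            ≡⟨ cong (λ vs → fixOn E vs S) (upTo-genStar Δ) ⟩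
    fixAt E S 0 ∧ fixOn E V S                   ≡⟨ cong (_∧ fixOn E V S) centre ⟩
    (degree S 0 <ᵇ suc (Δ / 2)) ∧ fixOn E V S   ≡⟨ ∧-comm _ (fixOn E V S) ⟩
    fixOn E V S ∧ (degree S 0 <ᵇ suc (Δ / 2))   ∎
    where
    open ≡-Reasoning
    E = spokes 1 Δ
    V = starVertices 1 Δ
    centre : fixAt E S 0 ≡ (degree S 0 <ᵇ suc (Δ / 2))
    centre = trans (fixAt-value E S 0 (degree-spokes-centre (s≤s z≤n) Δ) refl) (2*m≤ᵇn≡m<ᵇ1+n/2 (degree S 0) Δ)

  starCount-zero : ∀ c n → starCount c n 0 ≡ 0
  starCount-zero c n = trans (sumSublists-cong (spokes c n) (λ S _ → cong iverson (∧-zeroʳ _))) (sumSublists-zero (spokes c n))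

  starCount-suc : ∀ {c} → 0 < c → ∀ n r →
    starCount c (suc n) (suc r) ≡ fib m * starCount (c + suc m) n r + fib (suc m) * starCount (c + suc m) n (suc r)
  starCount-suc {c} 0<c n r = begin
    sumSublists (spoke 0 c m ++ E′) (λ S → g (suc r) S)
      ≡⟨ sumSublists-++ (spoke 0 c m) E′ _ ⟩
    sumSublists (path c m) (λ P → sumSublists E′ (λ S′ → g (suc r) ((0 , c) ∷ P ++ S′)))
      + sumSublists (path c m) (λ P → sumSublists E′ (λ S′ → g (suc r) (P ++ S′)))
      ≡⟨ cong₂ _+_ (sumSublists-cong (path c m) λ P P⊆ → sumSublists-cong E′ λ S′ S′⊆ →
                      split 1 (refl ∷ P⊆) S′⊆ (trans (degree-∷-incident (0 , c) P 0 (incident-fst 0 c)) (cong suc (centre-free P⊆))))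
                   (sumSublists-cong (path c m) λ P P⊆ → sumSublists-cong E′ λ S′ S′⊆ →
                      split 0 ((0 , c) ∷ʳ P⊆) S′⊆ (centre-free P⊆)) ⟩
    sumSublists (path c m) (λ P → sumSublists E′ (λ S′ → iverson (spokeFix 0 c m ((0 , c) ∷ P)) * rest r S′))
      + sumSublists (path c m) (λ P → sumSublists E′ (λ S′ → iverson (spokeFix 0 c m P) * rest (suc r) S′))
      ≡⟨ cong₂ _+_ (sumSublists-* (path c m) E′ _ (rest r)) (sumSublists-* (path c m) E′ _ (rest (suc r))) ⟩
    sumSublists (path c m) (λ P → iverson (spokeFix 0 c m ((0 , c) ∷ P))) * starCount (c + suc m) n r
      + sumSublists (path c m) (λ P → iverson (spokeFix 0 c m P)) * starCount (c + suc m) n (suc r)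
      ≡⟨ cong₂ _+_ (cong (_* starCount (c + suc m) n r) (spokeCount-with m 0<c))
                   (cong (_* starCount (c + suc m) n (suc r)) (spokeCount-without m 0<c)) ⟩
    fib m * starCount (c + suc m) n r + fib (suc m) * starCount (c + suc m) n (suc r) ∎
    where
    open ≡-Reasoning
    E′ = spokes (c + suc m) n
    V′ = starVertices (c + suc m) n
    g : ℕ → List Edge → ℕ
    g r S = iverson (fixOn (spokes c (suc n)) (starVertices c (suc n)) S ∧ (degree S 0 <ᵇ r))
    rest : ℕ → List Edge → ℕ
    rest r S′ = iverson (fixOn E′ V′ S′ ∧ (degree S′ 0 <ᵇ r))
    centre-free : ∀ {P} → P ⊆ path c m → degree P 0 ≡ 0
    centre-free P⊆ = ⊆-degree-≡0 {v = 0} P⊆ (degree-path-below m 0<c)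
    split : ∀ {S S′} k → S ⊆ spoke 0 c m → S′ ⊆ E′ → degree S 0 ≡ k →
            g (suc r) (S ++ S′) ≡ iverson (spokeFix 0 c m S) * iverson (fixOn E′ V′ S′ ∧ (k + degree S′ 0 <ᵇ suc r))
    split {S} {S′} k S⊆ S′⊆ S≡k =
      trans (cong₂ (λ x d → iverson (x ∧ (d <ᵇ suc r))) (fixOn-spokes-suc {n = n} 0<c S⊆ S′⊆)
                   (trans (degree-++ S S′ 0) (cong (_+ degree S′ 0) S≡k)))
            (iverson-∧∧ (spokeFix 0 c m S) _ _)

  starCount≡binomialPrefix : ∀ {c} → 0 < c → ∀ n r → starCount c n r ≡ binomialPrefix (fib m) (fib (suc m)) n r
  starCount≡binomialPrefix {c} 0<c n       zero    = starCount-zero c n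
  starCount≡binomialPrefix     0<c zero    (suc r) = sym (binomialPrefix-zero (fib m) (fib (suc m)) r)
  starCount≡binomialPrefix {c} 0<c (suc n) (suc r) = begin
    starCount c (suc n) (suc r)
      ≡⟨ starCount-suc 0<c n r ⟩
    fib m * starCount (c + suc m) n r + fib (suc m) * starCount (c + suc m) n (suc r)
      ≡⟨ cong₂ (λ x y → fib m * x + fib (suc m) * y) (starCount≡binomialPrefix 0<c′ n r) (starCount≡binomialPrefix 0<c′ n (suc r)) ⟩
    fib m * binomialPrefix (fib m) (fib (suc m)) n r + fib (suc m) * binomialPrefix (fib m) (fib (suc m)) n (suc r)
      ≡⟨ binomialPrefix-suc (fib m) (fib (suc m)) n r ⟨
    binomialPrefix (fib m) (fib (suc m)) (suc n) (suc r) ∎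
    where
    open ≡-Reasoning
    0<c′ = <-≤-trans 0<c (m≤m+n c (suc m))

corollary2 : (l Δ : ℕ) → l ≥ 1 → Δ ≥ 1 → numFix (genStar l Δ) ≡ starFormula l Δ
corollary2 zero    Δ ()  _
corollary2 (suc m) Δ _ _ = begin
  numFix (genStar (suc m) Δ)
    ≡⟨ numFix≡sumSublists (genStar (suc m) Δ) ⟩
  sumSublists E (λ S → iverson (fixOn E (upTo N) S))
    ≡⟨ cong (λ E → sumSublists E (λ S → iverson (fixOn E (upTo N) S))) (genStar-edges Δ) ⟩
  sumSublists (spokes 1 Δ) (λ S → iverson (fixOn (spokes 1 Δ) (upTo N) S))
    ≡⟨ sumSublists-cong (spokes 1 Δ) (λ S _ → cong iverson (fixOn-genStar Δ S)) ⟩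
  starCount 1 Δ (suc (Δ / 2))
    ≡⟨ starCount≡binomialPrefix (s≤s z≤n) Δ (suc (Δ / 2)) ⟩
  binomialPrefix (fib m) (fib (suc m)) Δ (suc (Δ / 2))
    ≡⟨ cong sum (map-upTo _ (suc (Δ / 2))) ⟨
  starFormula (suc m) Δ ∎
  where
  open Star m
  open ≡-Reasoning
  E = edges (genStar (suc m) Δ)
  N = suc m * Δ + 1
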